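{- Let $k$ be a positive integer and let $G_k$ be the graph with vertex set $A_k\cup B_k\cup C_k\cup D_k$, where $A_k=\{a_1,\ldots,a_{2k}\}$, $B_k=\{b_1,\ldots,b_{2k}\}$, $C_k=\{c_1,\ldots,c_k\}$, $D_k=\{d_1,\ldots,d_k\}$, and edge set $\{a_ib_i\mid 1\leqslant i\leqslant 2k\}\cup\{a_ic_j,\ b_id_j\mid 1\leqslant i\leqslant 2k,\ 1\leqslant j\leqslant k\}$. Then $mp(G_k)=k+1$ and $mp_f(G_k)=2$.
   Context: For a graph $G$ with an even number of vertices, the matching preclusion number $mp(G)$ is the minimum number of edges whose deletion leaves a graph with no perfect matching. Let $\mathcal{M}(G)$ be the set of perfect matchings of $G$ and $\bm{q}^M\in\mathbb{R}^{E(G)}$ the incidence vector of $M$. The fractional matching preclusion number $mp_f(G)$ is the optimal value of the linear program: minimize $\bm{1}^T\bm{y}$ over $\bm{y}\in\mathbb{R}^{E(G)}$ subject to $(\bm{q}^M)^T\bm{y}\geqslant 1$ for every $M\in\mathcal{M}(G)$ and $\bm{y}\geqslant 0$.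
   Formalization: The variable $\bm{y}$ of the linear program defining $mp_f$ has rational entries rather than real ones. -}

module Defs where

open import Data.Nat as ℕ using (ℕ; zero; suc)
open import Data.Fin using (Fin; zero; suc; _↑ˡ_; _↑ʳ_; splitAt; remQuot)
open import Data.Fin.Subset using (Subset; _∈_; _∉_; ∣_∣)
open import Data.Product using (Σ; _×_; _,_; ∃)
open import Data.Sum using (_⊎_; inj₁; inj₂)
open import Data.Bool using (true; false)
open import Data.Vec using (lookup)
open import Data.Rational as ℚ using (ℚ; 0ℚ; 1ℚ)
open import Relation.Binary.PropositionalEquality using (_≡_)
open import Relation.Nullary using (¬_)

record Graph : Set where
  field
    nV   : ℕ
    nE   : ℕ
    ends : Fin nE → Fin nV × Fin nV
open Graph public

Incident : (G : Graph) → Fin (nE G) → Fin (nV G) → Set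
Incident G e v with ends G e
... | (x , y) = (v ≡ x) ⊎ (v ≡ y)

IsPerfectMatching : (G : Graph) → Subset (nE G) → Set
IsPerfectMatching G M =
  ∀ (v : Fin (nV G)) → Σ (Fin (nE G)) λ e →
    (e ∈ M) × Incident G e v ×
    (∀ e′ → e′ ∈ M → Incident G e′ v → e′ ≡ e)

-- perfect matching of G − F (edge set F deleted): a perfect matching of G avoiding F
IsPerfectMatchingAvoiding : (G : Graph) → Subset (nE G) → Subset (nE G) → Set
IsPerfectMatchingAvoiding G F M =
  IsPerfectMatching G M × (∀ e → e ∈ M → e ∉ F)

Precludes : (G : Graph) → Subset (nE G) → Set
Precludes G F = ¬ (∃ λ M → IsPerfectMatchingAvoiding G F M)

MatchingPreclusionNumber : Graph → ℕ → Set
MatchingPreclusionNumber G m =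
  (Σ (Subset (nE G)) λ F → (∣ F ∣ ≡ m) × Precludes G F) ×
  (∀ (F : Subset (nE G)) → Precludes G F → m ℕ.≤ ∣ F ∣)

sumℚ : ∀ {n} → (Fin n → ℚ) → ℚ
sumℚ {zero}  f = 0ℚ
sumℚ {suc n} f = f zero ℚ.+ sumℚ (λ i → f (suc i))

incidenceDot : ∀ {n} → Subset n → (Fin n → ℚ) → ℚ
incidenceDot M y = sumℚ (λ e → indic (lookup M e) (y e))
  where
  indic : _ → ℚ → ℚ
  indic true  q = q
  indic false q = 0ℚ

FeasibleFMP : (G : Graph) → (Fin (nE G) → ℚ) → Set
FeasibleFMP G y =
  (∀ e → 0ℚ ℚ.≤ y e) ×
  (∀ (M : Subset (nE G)) → IsPerfectMatching G M → 1ℚ ℚ.≤ incidenceDot M y)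

FractionalMatchingPreclusionNumber : Graph → ℚ → Set
FractionalMatchingPreclusionNumber G r =
  (Σ (Fin (nE G) → ℚ) λ y → FeasibleFMP G y × (sumℚ y ≡ r)) ×
  (∀ y → FeasibleFMP G y → r ℚ.≤ sumℚ y)

-- The graph G_k.
-- Vertices: Fin (2k + (2k + (k + k))) = A_k ⊎ B_k ⊎ C_k ⊎ D_k.
-- Edges: Fin (2k + (2k*k + 2k*k)) : a_i b_i ; a_i c_j ; b_i d_j.
module _ (k : ℕ) where
  private
    n2 = 2 ℕ.* k

  vA : Fin n2 → Fin (n2 ℕ.+ (n2 ℕ.+ (k ℕ.+ k)))
  vA i = i ↑ˡ (n2 ℕ.+ (k ℕ.+ k))

  vB : Fin n2 → Fin (n2 ℕ.+ (n2 ℕ.+ (k ℕ.+ k)))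
  vB i = n2 ↑ʳ (i ↑ˡ (k ℕ.+ k))

  vC : Fin k → Fin (n2 ℕ.+ (n2 ℕ.+ (k ℕ.+ k)))
  vC j = n2 ↑ʳ (n2 ↑ʳ (j ↑ˡ k))

  vD : Fin k → Fin (n2 ℕ.+ (n2 ℕ.+ (k ℕ.+ k)))
  vD j = n2 ↑ʳ (n2 ↑ʳ (k ↑ʳ j))

  Gends : Fin (n2 ℕ.+ (n2 ℕ.* k ℕ.+ n2 ℕ.* k)) →
          Fin (n2 ℕ.+ (n2 ℕ.+ (k ℕ.+ k))) × Fin (n2 ℕ.+ (n2 ℕ.+ (k ℕ.+ k)))
  Gends e with splitAt n2 e
  ... | inj₁ i = vA i , vB i
  ... | inj₂ r with splitAt (n2 ℕ.* k) r
  ...   | inj₁ p with remQuot k p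
  ...     | (i , j) = vA i , vC j
  Gends e | inj₂ r | inj₂ p with remQuot k p
  ...     | (i , j) = vB i , vD j

  G : Graph
  G = record { nV = n2 ℕ.+ (n2 ℕ.+ (k ℕ.+ k))
             ; nE = n2 ℕ.+ (n2 ℕ.* k ℕ.+ n2 ℕ.* k)
             ; ends = Gends }

-- Every c_j is matched to some a_i, and every a_i not matched into C uses its edge a_i b_i, so a
-- perfect matching contains at least k of the edges a_i b_i. Deleting the k + 1 edges at a_i
-- isolates a_i, so mp ≤ k + 1. Conversely, given ∣F∣ ≤ k, pick a k-set S of indices with
-- a_i b_i ∉ F, and match the other a_i to C (the other b_i to D) by one of the k cyclic shifts
-- of a fixed bijection. The shifts are pairwise edge-disjoint, so if all of them met F, then F
-- would consist of k of their edges; S is chosen to rule this out, by containing the index of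
-- an edge of F (unless F contains some a_i b_i, which no shift uses). For mp_f, weight 1/k on
-- each a_i b_i is feasible with total 2, and the matchings built from S and from its complement
-- are disjoint, so every feasible weighting has total at least 2.

module Submission where

open import Algebra.Bundles using (CommutativeRing; CommutativeMonoid)
open import Data.Bool using (true; false; if_then_else_)
open import Data.Fin as Fin
  using (Fin; zero; suc; toℕ; fromℕ<; _↑ˡ_; _↑ʳ_; splitAt; combine)
open import Data.Fin.Properties as FinP
  using ( toℕ-injective; toℕ-fromℕ<; toℕ<n; toℕ≤n; suc-injective; any?; all?; ¬∀⟶∃¬
        ; splitAt-↑ˡ; splitAt-↑ʳ; splitAt⁻¹-↑ˡ; splitAt⁻¹-↑ʳ; ↑ˡ-injective; ↑ʳ-injective
        ; combine-injective; combine-surjective; remQuot-combine)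
open import Data.Fin.Subset
  using (Subset; inside; outside; _∈_; _∉_; _⊆_; ∣_∣; Empty; ∁; _∩_; ⊥; ⊤; ⁅_⁆)
open import Data.Fin.Subset.Properties
  using ( _∈?_; nonempty?; p⊆q⇒∣p∣≤∣q∣; s⊆s; out⊆; drop-∷-⊆; ⊥⊆; ⊆⊤
        ; x∈∁p⇒x∉p; x∉p⇒x∈∁p; x∈p∩q⁺; ∩-identityˡ; x∈⁅x⁆; x∈⁅y⁆⇒x≡y
        ; ∣∁p∣≡n∸∣p∣; ∣⊥∣≡0; ∣⊤∣≡n; ∣⁅x⁆∣≡1)
open import Data.Integer using (+_)
open import Data.Nat as ℕ using (ℕ; zero; suc; _+_; _*_; _∸_; _%_; _≤_; z≤n; s≤s; NonZero)
open import Data.Nat.DivMod using (_mod_; m%n<n; %-distribˡ-+; m%n%n≡m%n; [m+n]%n≡m%n; m<n⇒m%n≡m)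
open import Data.Nat.Properties as ℕP using (≤-trans; ≤-antisym; <⇒≱; +-comm)
open import Data.Product using (∃; ∃₂; _×_; _,_; proj₁; proj₂; map₁; map₂)
open import Data.Rational as ℚ using (ℚ; 0ℚ; 1ℚ; 1/_; _/_; Positive; NonNegative)
open import Data.Rational.Properties as ℚP using ()
open import Data.Sum using (_⊎_; inj₁; inj₂; [_,_]′)
open import Data.Vec using (_∷_; []; here; there; tabulate; lookup)
open import Data.Vec.Properties using (lookup∘tabulate; lookup⇒[]=; []=⇒lookup)
open import Function using (_∘_; case_of_)
open import Function.Definitions using (Injective)
open import Level using (Level)
open import Relation.Binary.PropositionalEquality
  using (_≡_; _≢_; refl; sym; trans; cong; cong₂; subst; ≢-sym; module ≡-Reasoning)
open import Relation.Nullary using (Dec; yes; no; does; ¬_; ¬?; contradiction)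
open import Relation.Nullary.Decidable using (dec-true; dec-false; decidable-stable; _⊎-dec_; _×-dec_)
open import Relation.Unary using (Pred; Decidable)

open import Algebra.Properties.CommutativeSemigroup
  (CommutativeMonoid.commutativeSemigroup ℚP.+-0-commutativeMonoid) using (interchange)
open import Algebra.Properties.Semiring.Mult (CommutativeRing.semiring ℚP.+-*-commutativeRing)
  using (×-homo-+; ×-assoc-*) renaming (_×_ to _·_)

open import Defs

private
  variable
    ℓ : Level
    m n k : ℕ
    x y : Fin n
    p : Subset n

↑ˡ≢↑ʳ : ∀ {m n} (i : Fin m) (j : Fin n) → i ↑ˡ n ≢ m ↑ʳ j
↑ˡ≢↑ʳ {m} {n} i j eq =
  case trans (sym (splitAt-↑ˡ m i n)) (trans (cong (splitAt m) eq) (splitAt-↑ʳ m n j)) of λ ()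

select : {P : Pred (Fin n) ℓ} → Decidable P → Subset n
select P? = tabulate (does ∘ P?)

module _ {P : Pred (Fin n) ℓ} (P? : Decidable P) where

  ∈-select⁺ : P x → x ∈ select P?
  ∈-select⁺ {x} px = lookup⇒[]= x _ (trans (lookup∘tabulate _ x) (dec-true (P? x) px))

  ∈-select⁻ : x ∈ select P? → P x
  ∈-select⁻ {x} x∈ with P? x | trans (sym (lookup∘tabulate (does ∘ P?) x)) ([]=⇒lookup x∈)
  ... | yes px | _ = px

enum : (p : Subset n) → Fin ∣ p ∣ → Fin n
enum (inside  ∷ p) zero    = zero
enum (inside  ∷ p) (suc t) = suc (enum p t)
enum (outside ∷ p) t       = suc (enum p t)

enum-∈ : (p : Subset n) (t : Fin ∣ p ∣) → enum p t ∈ p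
enum-∈ (inside  ∷ p) zero    = here
enum-∈ (inside  ∷ p) (suc t) = there (enum-∈ p t)
enum-∈ (outside ∷ p) t       = there (enum-∈ p t)

enum-injective : (p : Subset n) → Injective _≡_ _≡_ (enum p)
enum-injective (inside  ∷ p) {zero}  {zero}  _  = refl
enum-injective (inside  ∷ p) {suc s} {suc t} eq = cong suc (enum-injective p (suc-injective eq))
enum-injective (outside ∷ p)                 eq = enum-injective p (suc-injective eq)

rank : x ∈ p → Fin ∣ p ∣
rank {p = inside  ∷ p} here      = zero
rank {p = inside  ∷ p} (there h) = suc (rank h)
rank {p = outside ∷ p} (there h) = rank h

enum-rank : (h : x ∈ p) → enum p (rank h) ≡ x
enum-rank {p = inside  ∷ p} here      = refl
enum-rank {p = inside  ∷ p} (there h) = cong suc (enum-rank h)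
enum-rank {p = outside ∷ p} (there h) = cong suc (enum-rank h)

rank-injective : (h : x ∈ p) (h′ : y ∈ p) → rank h ≡ rank h′ → x ≡ y
rank-injective {p = p} h h′ eq = trans (sym (enum-rank h)) (trans (cong (enum p) eq) (enum-rank h′))

injective⇒≤∣p∣ : (f : Fin m → Fin n) → Injective _≡_ _≡_ f → (∀ t → f t ∈ p) → m ≤ ∣ p ∣
injective⇒≤∣p∣ f f-injective f∈p =
  FinP.injective⇒≤ {f = rank ∘ f∈p} (f-injective ∘ rank-injective (f∈p _) (f∈p _))

covered⇒∣p∣≤ : (g : Fin m → Fin n) → (∀ {x} → x ∈ p → ∃ λ t → g t ≡ x) → ∣ p ∣ ≤ m
covered⇒∣p∣≤ {p = p} g cover = FinP.injective⇒≤ {f = proj₁ ∘ cover ∘ enum-∈ p} λ {s} {t} eq →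
  enum-injective p (trans (sym (proj₂ (cover (enum-∈ p s)))) (trans (cong g eq) (proj₂ (cover (enum-∈ p t)))))

⊆-interpolate : ∀ {u w : Subset n} → u ⊆ w → ∣ u ∣ ≤ m → m ≤ ∣ w ∣ →
                ∃ λ s → u ⊆ s × s ⊆ w × ∣ s ∣ ≡ m
⊆-interpolate {u = []} {[]} _ _ z≤n = [] , (λ ()) , (λ ()) , refl
⊆-interpolate {u = inside ∷ u} {outside ∷ w} u⊆w _ _ = case u⊆w here of λ ()
⊆-interpolate {m = suc m} {u = inside ∷ u} {inside ∷ w} u⊆w (s≤s u≤m) (s≤s m≤w)
  with s , u⊆s , s⊆w , ∣s∣ ← ⊆-interpolate (drop-∷-⊆ u⊆w) u≤m m≤w
  = inside ∷ s , s⊆s u⊆s , s⊆s s⊆w , cong suc ∣s∣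
⊆-interpolate {u = outside ∷ u} {outside ∷ w} u⊆w u≤m m≤w
  with s , u⊆s , s⊆w , ∣s∣ ← ⊆-interpolate (drop-∷-⊆ u⊆w) u≤m m≤w
  = outside ∷ s , s⊆s u⊆s , s⊆s s⊆w , ∣s∣
⊆-interpolate {m = m} {u = outside ∷ u} {inside ∷ w} u⊆w u≤m m≤1+w with m ℕP.≤? ∣ w ∣
... | yes m≤w with s , u⊆s , s⊆w , ∣s∣ ← ⊆-interpolate (drop-∷-⊆ u⊆w) u≤m m≤w
  = outside ∷ s , s⊆s u⊆s , out⊆ s⊆w , ∣s∣
⊆-interpolate {m = suc m} {u = outside ∷ u} {inside ∷ w} u⊆w _ (s≤s m≤w) | no m≰w
  with s , u⊆s , s⊆w , ∣s∣ ← ⊆-interpolate (drop-∷-⊆ u⊆w)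
                               (≤-trans (p⊆q⇒∣p∣≤∣q∣ (drop-∷-⊆ u⊆w)) (ℕP.≤-pred (ℕP.≰⇒> m≰w))) m≤w
  = inside ∷ s , out⊆ u⊆s , s⊆s s⊆w , cong suc ∣s∣
⊆-interpolate {m = zero} {u = outside ∷ u} {inside ∷ w} _ _ _ | no m≰w = contradiction z≤n m≰w

record _↔Fin_ (p : Subset n) (k : ℕ) : Set where
  field
    to      : Fin n → Fin k
    from    : Fin k → Fin n
    from-∈  : ∀ t → from t ∈ p
    to-from : ∀ t → to (from t) ≡ t
    from-to : x ∈ p → from (to x) ≡ x

open _↔Fin_

from-injective : (γ : p ↔Fin k) → Injective _≡_ _≡_ (from γ)
from-injective γ {s} {t} eq = trans (sym (to-from γ s)) (trans (cong (to γ) eq) (to-from γ t))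

-- The second argument is the junk value of `to` outside p.
↔Fin-of-size : ∣ p ∣ ≡ k → Fin k → p ↔Fin k
↔Fin-of-size {p = p} refl junk = record
  { to      = index
  ; from    = enum p
  ; from-∈  = enum-∈ p
  ; to-from = λ t → enum-injective p (enum-index (enum-∈ p t))
  ; from-to = enum-index
  }
  where
  index : Fin _ → Fin ∣ p ∣
  index x with x ∈? p
  ... | yes h = rank h
  ... | no  _ = junk

  enum-index : x ∈ p → enum p (index x) ≡ x
  enum-index {x} h with x ∈? p
  ... | yes h′ = enum-rank h′
  ... | no  h∉ = contradiction h h∉

-- Cyclic shifts of Fin k

module _ {k : ℕ} .{{_ : NonZero k}} where

  rotate unrotate : Fin k → Fin k → Fin k
  rotate   r t = (toℕ t + toℕ r) mod k
  unrotate r t = (toℕ t + (k ∸ toℕ r)) mod k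

  private
    toℕ-mod : ∀ m → toℕ (m mod k) ≡ m % k
    toℕ-mod m = toℕ-fromℕ< (m%n<n m k)

    [m%k+n]%k≡[m+n]%k : ∀ m n → (m % k + n) % k ≡ (m + n) % k
    [m%k+n]%k≡[m+n]%k m n = begin
      (m % k + n) % k           ≡⟨ %-distribˡ-+ (m % k) n k ⟩
      (m % k % k + n % k) % k   ≡⟨ cong (λ z → (z + n % k) % k) (m%n%n≡m%n m k) ⟩
      (m % k + n % k) % k       ≡⟨ %-distribˡ-+ m n k ⟨
      (m + n) % k               ∎
      where open ≡-Reasoning

    -- unrotate r ∘ rotate r and rotate r ∘ unrotate r both add toℕ r + (k ∸ toℕ r) = k
    cancel : ∀ (t : Fin k) a b → a + b ≡ k →
             toℕ ((toℕ ((toℕ t + a) mod k) + b) mod k) ≡ toℕ t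
    cancel t a b a+b≡k = begin
      toℕ ((toℕ ((toℕ t + a) mod k) + b) mod k) ≡⟨ toℕ-mod _ ⟩
      (toℕ ((toℕ t + a) mod k) + b) % k         ≡⟨ cong (λ z → (z + b) % k) (toℕ-mod _) ⟩
      ((toℕ t + a) % k + b) % k                 ≡⟨ [m%k+n]%k≡[m+n]%k _ b ⟩
      (toℕ t + a + b) % k                       ≡⟨ cong (_% k) (ℕP.+-assoc (toℕ t) a b) ⟩
      (toℕ t + (a + b)) % k                     ≡⟨ cong (λ z → (toℕ t + z) % k) a+b≡k ⟩
      (toℕ t + k) % k                           ≡⟨ [m+n]%n≡m%n (toℕ t) k ⟩
      toℕ t % k                                 ≡⟨ m<n⇒m%n≡m (toℕ<n t) ⟩
      toℕ t                                     ∎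
      where open ≡-Reasoning

  unrotate-rotate : ∀ r t → unrotate r (rotate r t) ≡ t
  unrotate-rotate r t = toℕ-injective (cancel t (toℕ r) (k ∸ toℕ r) (ℕP.m+[n∸m]≡n (toℕ≤n r)))

  rotate-unrotate : ∀ r t → rotate r (unrotate r t) ≡ t
  rotate-unrotate r t = toℕ-injective (cancel t (k ∸ toℕ r) (toℕ r) (ℕP.m∸n+n≡m (toℕ≤n r)))

  rotate-comm : ∀ r t → rotate r t ≡ rotate t r
  rotate-comm r t = cong (_mod k) (ℕP.+-comm (toℕ t) (toℕ r))

  rotate-injectiveˡ : ∀ {r r′} t → rotate r t ≡ rotate r′ t → r ≡ r′
  rotate-injectiveˡ {r} {r′} t eq = begin
    r                         ≡⟨ unrotate-rotate t r ⟨
    unrotate t (rotate t r)   ≡⟨ cong (unrotate t) (trans (rotate-comm t r) (trans eq (rotate-comm r′ t))) ⟩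
    unrotate t (rotate t r′)  ≡⟨ unrotate-rotate t r′ ⟩
    r′                        ∎
    where open ≡-Reasoning

  rotated : p ↔Fin k → Fin k → p ↔Fin k
  rotated ε r = record
    { to      = rotate r ∘ to ε
    ; from    = from ε ∘ unrotate r
    ; from-∈  = from-∈ ε ∘ unrotate r
    ; to-from = λ t → trans (cong (rotate r) (to-from ε (unrotate r t))) (rotate-unrotate r t)
    ; from-to = λ {x} h → trans (cong (from ε) (unrotate-rotate r (to ε x))) (from-to ε h)
    }

  module _ {n : ℕ} (F : Subset n) (ed : Fin k → Fin k → Fin n)
           (ed-injective : ∀ {s t i j} → ed s i ≡ ed t j → s ≡ t × i ≡ j) where

    Escapes : Set
    Escapes = Empty F ⊎ ∃ λ e → e ∈ F × ∀ t j → ed t j ≢ e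

    -- The k rotations are pairwise edge-disjoint perfect matchings of K_{k,k}; if each met F,
    -- these k edges of F together with an escaping one would give ∣ F ∣ > k.
    rotation-avoiding : ∣ F ∣ ≤ k → Escapes → ∃ λ r → ∀ t → ed t (rotate r t) ∉ F
    rotation-avoiding ∣F∣≤k escapes
      with any? (λ r → all? (λ t → ¬? (ed t (rotate r t) ∈? F)))
    ... | yes avoiding = avoiding
    ... | no none = contradiction escapes refuted
      where
      hit : ∀ r → ∃ λ t → ed t (rotate r t) ∈ F
      hit r with t , ¬∉ ← ¬∀⟶∃¬ k _ (λ t → ¬? (ed t (rotate r t) ∈? F)) (λ avoids → none (r , avoids))
        = t , decidable-stable (_ ∈? F) ¬∉

      refuted : ¬ Escapes
      refuted (inj₁ empty) = empty (_ , proj₂ (hit (fromℕ< (ℕ.>-nonZero⁻¹ k))))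
      refuted (inj₂ (e , e∈F , e-escapes)) =
        <⇒≱ (s≤s ∣F∣≤k) (injective⇒≤∣p∣ witness witness-injective witness-∈)
        where
        witness : Fin (suc k) → Fin n
        witness zero    = e
        witness (suc r) = ed (proj₁ (hit r)) (rotate r (proj₁ (hit r)))

        witness-∈ : ∀ t → witness t ∈ F
        witness-∈ zero    = e∈F
        witness-∈ (suc r) = proj₂ (hit r)

        witness-injective : Injective _≡_ _≡_ witness
        witness-injective {zero}  {zero}   _  = refl
        witness-injective {zero}  {suc r}  eq = contradiction (sym eq) (e-escapes _ _)
        witness-injective {suc r} {zero}   eq = contradiction eq (e-escapes _ _)
        witness-injective {suc r} {suc r′} eq with ed-injective eq
        ... | s≡s′ , rot≡rot′ =
          cong suc (rotate-injectiveˡ _ (trans rot≡rot′ (cong (rotate r′) (sym s≡s′))))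

-- Weightings of the edges

constOn : Subset n → ℚ → Fin n → ℚ
constOn P c e = if lookup P e then c else 0ℚ

constOn-nonNegative : ∀ (P : Subset n) {c} → 0ℚ ℚ.≤ c → ∀ e → 0ℚ ℚ.≤ constOn P c e
constOn-nonNegative P 0≤c e with lookup P e
... | true  = 0≤c
... | false = ℚP.≤-refl

incidenceDot-constOn : ∀ (M P : Subset n) c → incidenceDot M (constOn P c) ≡ ∣ M ∩ P ∣ · c
incidenceDot-constOn []          []          c = refl
incidenceDot-constOn (true  ∷ M) (true  ∷ P) c = cong (c ℚ.+_) (incidenceDot-constOn M P c)
incidenceDot-constOn (true  ∷ M) (false ∷ P) c = trans (ℚP.+-identityˡ _) (incidenceDot-constOn M P c)
incidenceDot-constOn (false ∷ M) (_     ∷ P) c = trans (ℚP.+-identityˡ _) (incidenceDot-constOn M P c)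

incidenceDot-⊤ : (y : Fin n → ℚ) → incidenceDot ⊤ y ≡ sumℚ y
incidenceDot-⊤ {zero}  y = refl
incidenceDot-⊤ {suc n} y = cong (y zero ℚ.+_) (incidenceDot-⊤ (y ∘ suc))

incidenceDot-disjoint : ∀ (M M′ : Subset n) (y : Fin n → ℚ) → (∀ e → 0ℚ ℚ.≤ y e) →
                        (∀ {e} → e ∈ M → e ∉ M′) →
                        incidenceDot M y ℚ.+ incidenceDot M′ y ℚ.≤ sumℚ y
incidenceDot-disjoint []      []        y y≥0 disjoint = ℚP.≤-refl
incidenceDot-disjoint (b ∷ M) (b′ ∷ M′) y y≥0 disjoint = split b b′ disjoint
  where
  D D′ : ℚ
  D  = incidenceDot M  (y ∘ suc)
  D′ = incidenceDot M′ (y ∘ suc)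

  step : ∀ a a′ → a ℚ.+ a′ ℚ.≤ y zero → (a ℚ.+ D) ℚ.+ (a′ ℚ.+ D′) ℚ.≤ sumℚ y
  step a a′ head = ℚP.≤-trans (ℚP.≤-reflexive (interchange a D a′ D′)) (ℚP.+-mono-≤ head
    (incidenceDot-disjoint M M′ (y ∘ suc) (y≥0 ∘ suc) (λ h h′ → disjoint (there h) (there h′))))

  split : ∀ b b′ → (∀ {e} → e ∈ b ∷ M → e ∉ b′ ∷ M′) →
          incidenceDot (b ∷ M) y ℚ.+ incidenceDot (b′ ∷ M′) y ℚ.≤ sumℚ y
  split true  true  disjoint = contradiction here (disjoint here)
  split true  false _ = step (y zero) 0ℚ (ℚP.≤-reflexive (ℚP.+-identityʳ (y zero)))
  split false true  _ = step 0ℚ (y zero) (ℚP.≤-reflexive (ℚP.+-identityˡ (y zero)))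
  split false false _ = step 0ℚ 0ℚ (y≥0 zero)

module _ {c : ℚ} (0≤c : 0ℚ ℚ.≤ c) where

  0≤·c : ∀ n → 0ℚ ℚ.≤ n · c
  0≤·c zero    = ℚP.≤-refl
  0≤·c (suc n) = ℚP.+-mono-≤ 0≤c (0≤·c n)

  ·-monoˡ-≤ : m ≤ n → m · c ℚ.≤ n · c
  ·-monoˡ-≤ {n = n} z≤n = 0≤·c n
  ·-monoˡ-≤ (s≤s m≤n)   = ℚP.+-monoʳ-≤ c (·-monoˡ-≤ m≤n)

private
  ·1-nonNegative : ∀ n → NonNegative (n · 1ℚ)
  ·1-nonNegative zero    = _
  ·1-nonNegative (suc n) = ℚP.nonNeg+nonNeg⇒nonNeg 1ℚ (n · 1ℚ) {{·1-nonNegative n}}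

  ·1-positive : ∀ n .{{_ : NonZero n}} → Positive (n · 1ℚ)
  ·1-positive (suc n) = ℚP.pos+nonNeg⇒pos 1ℚ (n · 1ℚ) {{·1-nonNegative n}}

module _ (k : ℕ) .{{_ : NonZero k}} where

  private
    instance
      k·1≢0 : ℚ.NonZero (k · 1ℚ)
      k·1≢0 = ℚP.pos⇒nonZero (k · 1ℚ) {{·1-positive k}}

  1/ℕ : ℚ
  1/ℕ = 1/ (k · 1ℚ)

  0≤1/ℕ : 0ℚ ℚ.≤ 1/ℕ
  0≤1/ℕ = ℚP.nonNegative⁻¹ 1/ℕ {{ℚP.pos⇒nonNeg 1/ℕ {{ℚP.1/pos⇒pos (k · 1ℚ) {{·1-positive k}}}}}}

  k·1/ℕ≡1 : k · 1/ℕ ≡ 1ℚ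
  k·1/ℕ≡1 = begin
    k · 1/ℕ               ≡⟨ cong (k ·_) (ℚP.*-identityˡ 1/ℕ) ⟨
    k · (1ℚ ℚ.* 1/ℕ)      ≡⟨ ×-assoc-* k 1ℚ 1/ℕ ⟨
    (k · 1ℚ) ℚ.* 1/ℕ      ≡⟨ ℚP.*-inverseʳ (k · 1ℚ) ⟩
    1ℚ                    ∎
    where open ≡-Reasoning

incident? : (G : Graph) → ∀ e v → Dec (Incident G e v)
incident? G e v = v Fin.≟ proj₁ (ends G e) ⊎-dec v Fin.≟ proj₂ (ends G e)

module _ (G : Graph) {e : Fin (nE G)} {v x y : Fin (nV G)} (ends≡ : ends G e ≡ (x , y)) where

  incident⁻ : Incident G e v → v ≡ x ⊎ v ≡ y
  incident⁻ = subst (λ (x , y) → v ≡ x ⊎ v ≡ y) ends≡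

  incident⁺ : v ≡ x ⊎ v ≡ y → Incident G e v
  incident⁺ = subst (λ (x , y) → v ≡ x ⊎ v ≡ y) (sym ends≡)

star : (G : Graph) → Fin (nV G) → Subset (nE G)
star G v = select (λ e → incident? G e v)

star-precludes : (G : Graph) (v : Fin (nV G)) → Precludes G (star G v)
star-precludes G v (M , perfect , avoids) with perfect v
... | e , e∈M , e∼v , _ = avoids e e∈M (∈-select⁺ (λ e → incident? G e v) e∼v)

disjoint-perfect-matchings⇒2≤ : (G : Graph) {M M′ : Subset (nE G)} →
  IsPerfectMatching G M → IsPerfectMatching G M′ → (∀ {e} → e ∈ M → e ∉ M′) →
  ∀ y → FeasibleFMP G y → 1ℚ ℚ.+ 1ℚ ℚ.≤ sumℚ y
disjoint-perfect-matchings⇒2≤ G {M} {M′} perfect perfect′ disjoint y (y≥0 , covers) =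
  ℚP.≤-trans (ℚP.+-mono-≤ (covers M perfect) (covers M′ perfect′)) (incidenceDot-disjoint M M′ y y≥0 disjoint)

-- The graph G_k

module _ (k : ℕ) .{{_ : NonZero k}} where

  private
    Index  = Fin (2 * k)
    Edge   = Fin (nE (G k))
    Vertex = Fin (nV (G k))

    variable
      i i′ : Index
      j j′ : Fin k

  a b : Index → Vertex
  a = vA k
  b = vB k

  c d : Fin k → Vertex
  c = vC k
  d = vD k

  ab : Index → Edge
  ab i = i ↑ˡ (2 * k * k + 2 * k * k)

  ac bd : Index → Fin k → Edge
  ac i j = 2 * k ↑ʳ (combine i j ↑ˡ 2 * k * k)
  bd i j = 2 * k ↑ʳ 2 * k * k ↑ʳ combine i j

  ends-ab : ∀ i → ends (G k) (ab i) ≡ (a i , b i)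
  ends-ab i rewrite splitAt-↑ˡ (2 * k) i (2 * k * k + 2 * k * k) = refl

  ends-ac : ∀ i j → ends (G k) (ac i j) ≡ (a i , c j)
  ends-ac i j
    rewrite splitAt-↑ʳ (2 * k) (2 * k * k + 2 * k * k) (combine i j ↑ˡ 2 * k * k)
          | splitAt-↑ˡ (2 * k * k) (combine i j) (2 * k * k)
    = cong (λ (i , j) → a i , c j) (remQuot-combine i j)

  ends-bd : ∀ i j → ends (G k) (bd i j) ≡ (b i , d j)
  ends-bd i j
    rewrite splitAt-↑ʳ (2 * k) (2 * k * k + 2 * k * k) (2 * k * k ↑ʳ combine i j)
          | splitAt-↑ʳ (2 * k * k) (2 * k * k) (combine i j)
    = cong (λ (i , j) → b i , d j) (remQuot-combine i j)

  a-injective : a i ≡ a i′ → i ≡ i′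
  a-injective = ↑ˡ-injective _ _ _

  a≢b : a i ≢ b i′
  a≢b = ↑ˡ≢↑ʳ _ _

  a≢c : a i ≢ c j
  a≢c = ↑ˡ≢↑ʳ _ _

  a≢d : a i ≢ d j
  a≢d = ↑ˡ≢↑ʳ _ _

  ab-injective : ab i ≡ ab i′ → i ≡ i′
  ab-injective = ↑ˡ-injective _ _ _

  ac-injective : ac i j ≡ ac i′ j′ → i ≡ i′ × j ≡ j′
  ac-injective eq = combine-injective _ _ _ _ (↑ˡ-injective (2 * k * k) _ _ (↑ʳ-injective (2 * k) _ _ eq))

  bd-injective : bd i j ≡ bd i′ j′ → i ≡ i′ × j ≡ j′
  bd-injective eq = combine-injective _ _ _ _ (↑ʳ-injective (2 * k * k) _ _ (↑ʳ-injective (2 * k) _ _ eq))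

  ab≢ac : ab i ≢ ac i′ j
  ab≢ac = ↑ˡ≢↑ʳ _ _

  ab≢bd : ab i ≢ bd i′ j
  ab≢bd = ↑ˡ≢↑ʳ _ _

  ac≢bd : ac i j ≢ bd i′ j′
  ac≢bd eq = ↑ˡ≢↑ʳ _ _ (↑ʳ-injective (2 * k) _ _ eq)

  data EdgeView : Edge → Set where
    AB : ∀ i   → EdgeView (ab i)
    AC : ∀ i j → EdgeView (ac i j)
    BD : ∀ i j → EdgeView (bd i j)

  edgeView : ∀ e → EdgeView e
  edgeView e with splitAt (2 * k) e in eq
  ... | inj₁ i = subst EdgeView (splitAt⁻¹-↑ˡ eq) (AB i)
  ... | inj₂ r with splitAt (2 * k * k) r in eq′
  ...   | inj₁ p with i , j , refl ← combine-surjective {2 * k} {k} p =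
    subst EdgeView (trans (cong (2 * k ↑ʳ_) (splitAt⁻¹-↑ˡ eq′)) (splitAt⁻¹-↑ʳ eq)) (AC i j)
  ...   | inj₂ p with i , j , refl ← combine-surjective {2 * k} {k} p =
    subst EdgeView (trans (cong (2 * k ↑ʳ_) (splitAt⁻¹-↑ʳ eq′)) (splitAt⁻¹-↑ʳ eq)) (BD i j)

  data VertexView : Vertex → Set where
    A : ∀ i → VertexView (a i)
    B : ∀ i → VertexView (b i)
    C : ∀ j → VertexView (c j)
    D : ∀ j → VertexView (d j)

  vertexView : ∀ v → VertexView v
  vertexView v with splitAt (2 * k) v in eq
  ... | inj₁ i = subst VertexView (splitAt⁻¹-↑ˡ eq) (A i)
  ... | inj₂ r with splitAt (2 * k) r in eq′
  ...   | inj₁ i = subst VertexView (trans (cong (2 * k ↑ʳ_) (splitAt⁻¹-↑ˡ eq′)) (splitAt⁻¹-↑ʳ eq)) (B i)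
  ...   | inj₂ q with splitAt k q in eq″
  ...     | inj₁ j = subst VertexView (trans (cong (λ q → 2 * k ↑ʳ 2 * k ↑ʳ q) (splitAt⁻¹-↑ˡ eq″))
                                        (trans (cong (2 * k ↑ʳ_) (splitAt⁻¹-↑ʳ eq′)) (splitAt⁻¹-↑ʳ eq))) (C j)
  ...     | inj₂ j = subst VertexView (trans (cong (λ q → 2 * k ↑ʳ 2 * k ↑ʳ q) (splitAt⁻¹-↑ʳ eq″))
                                        (trans (cong (2 * k ↑ʳ_) (splitAt⁻¹-↑ʳ eq′)) (splitAt⁻¹-↑ʳ eq))) (D j)

  vertexCase : {X : Set} → (Index → X) → (Index → X) → (Fin k → X) → (Fin k → X) → Vertex → X
  vertexCase fa fb fc fd v = [ fa , [ fb , [ fc , fd ]′ ∘ splitAt k ]′ ∘ splitAt (2 * k) ]′ (splitAt (2 * k) v)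

  module _ {X : Set} {fa fb : Index → X} {fc fd : Fin k → X} where

    vertexCase-a : ∀ i → vertexCase fa fb fc fd (a i) ≡ fa i
    vertexCase-a i rewrite splitAt-↑ˡ (2 * k) i (2 * k + (k + k)) = refl

    vertexCase-b : ∀ i → vertexCase fa fb fc fd (b i) ≡ fb i
    vertexCase-b i rewrite splitAt-↑ʳ (2 * k) (2 * k + (k + k)) (i ↑ˡ (k + k))
                         | splitAt-↑ˡ (2 * k) i (k + k) = refl

    vertexCase-c : ∀ j → vertexCase fa fb fc fd (c j) ≡ fc j
    vertexCase-c j rewrite splitAt-↑ʳ (2 * k) (2 * k + (k + k)) (2 * k ↑ʳ (j ↑ˡ k))
                         | splitAt-↑ʳ (2 * k) (k + k) (j ↑ˡ k)
                         | splitAt-↑ˡ k j k = refl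

    vertexCase-d : ∀ j → vertexCase fa fb fc fd (d j) ≡ fd j
    vertexCase-d j rewrite splitAt-↑ʳ (2 * k) (2 * k + (k + k)) (2 * k ↑ʳ (k ↑ʳ j))
                         | splitAt-↑ʳ (2 * k) (k + k) (k ↑ʳ j)
                         | splitAt-↑ʳ k k j = refl

  incident-a : ∀ {e} → Incident (G k) e (a i) → e ≡ ab i ⊎ ∃ λ j → e ≡ ac i j
  incident-a {e = e} = classify (edgeView e)
    where
    classify : ∀ {e} → EdgeView e → Incident (G k) e (a i) → e ≡ ab i ⊎ ∃ λ j → e ≡ ac i j
    classify (AB i′) e∼a with incident⁻ (G k) (ends-ab i′) e∼a
    ... | inj₁ a≡a = inj₁ (cong ab (sym (a-injective a≡a)))
    ... | inj₂ a≡b = contradiction a≡b a≢b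
    classify (AC i′ j) e∼a with incident⁻ (G k) (ends-ac i′ j) e∼a
    ... | inj₁ a≡a = inj₂ (j , cong (λ i → ac i j) (sym (a-injective a≡a)))
    ... | inj₂ a≡c = contradiction a≡c a≢c
    classify (BD i′ j) e∼a with incident⁻ (G k) (ends-bd i′ j) e∼a
    ... | inj₁ a≡b = contradiction a≡b a≢b
    ... | inj₂ a≡d = contradiction a≡d a≢d

  module _ (S : Subset (2 * k)) (α β : ∁ S ↔Fin k) where

    Matched : Edge → Set
    Matched e = (∃ λ i → i ∈ S × e ≡ ab i)
              ⊎ (∃ λ i → i ∈ ∁ S × e ≡ ac i (to α i))
              ⊎ (∃ λ i → i ∈ ∁ S × e ≡ bd i (to β i))

    matched? : Decidable Matched
    matched? e = any? (λ i → i ∈? S ×-dec e Fin.≟ ab i)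
          ⊎-dec any? (λ i → i ∈? ∁ S ×-dec e Fin.≟ ac i (to α i))
          ⊎-dec any? (λ i → i ∈? ∁ S ×-dec e Fin.≟ bd i (to β i))

    matching : Subset (nE (G k))
    matching = select matched?

    private
      partnerOf : (Index → Fin k → Edge) → ∁ S ↔Fin k → Index → Edge
      partnerOf cross γ i = if does (i ∈? S) then ab i else cross i (to γ i)

      partnerOf-∈ : ∀ cross γ → i ∈ S → partnerOf cross γ i ≡ ab i
      partnerOf-∈ {i} cross γ h = cong (if_then ab i else cross i (to γ i)) (dec-true (i ∈? S) h)

      partnerOf-∉ : ∀ cross γ → i ∈ ∁ S → partnerOf cross γ i ≡ cross i (to γ i)
      partnerOf-∉ {i} cross γ h =
        cong (if_then ab i else cross i (to γ i)) (dec-false (i ∈? S) (x∈∁p⇒x∉p h))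

      partner : Vertex → Edge
      partner = vertexCase (partnerOf ac α) (partnerOf bd β) (λ j → ac (from α j) j) (λ j → bd (from β j) j)

      partner-covers : ∀ v → partner v ∈ matching × Incident (G k) (partner v) v
      partner-covers v = covers (vertexView v)
        where
        covered-by : ∀ {e v} → partner v ≡ e → Matched e → Incident (G k) e v →
                     partner v ∈ matching × Incident (G k) (partner v) v
        covered-by refl m e∼v = ∈-select⁺ matched? m , e∼v

        covers : ∀ {v} → VertexView v → partner v ∈ matching × Incident (G k) (partner v) v
        covers (A i) with i ∈? S
        ... | yes h = covered-by (trans (vertexCase-a i) (partnerOf-∈ ac α h))
                        (inj₁ (i , h , refl)) (incident⁺ (G k) (ends-ab i) (inj₁ refl))
        ... | no  h = covered-by (trans (vertexCase-a i) (partnerOf-∉ ac α (x∉p⇒x∈∁p h)))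
                        (inj₂ (inj₁ (i , x∉p⇒x∈∁p h , refl))) (incident⁺ (G k) (ends-ac i _) (inj₁ refl))
        covers (B i) with i ∈? S
        ... | yes h = covered-by (trans (vertexCase-b i) (partnerOf-∈ bd β h))
                        (inj₁ (i , h , refl)) (incident⁺ (G k) (ends-ab i) (inj₂ refl))
        ... | no  h = covered-by (trans (vertexCase-b i) (partnerOf-∉ bd β (x∉p⇒x∈∁p h)))
                        (inj₂ (inj₂ (i , x∉p⇒x∈∁p h , refl))) (incident⁺ (G k) (ends-bd i _) (inj₁ refl))
        covers (C j) = covered-by (vertexCase-c j)
                         (inj₂ (inj₁ (from α j , from-∈ α j , cong (ac _) (sym (to-from α j)))))
                         (incident⁺ (G k) (ends-ac _ j) (inj₂ refl))
        covers (D j) = covered-by (vertexCase-d j)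
                         (inj₂ (inj₂ (from β j , from-∈ β j , cong (bd _) (sym (to-from β j)))))
                         (incident⁺ (G k) (ends-bd _ j) (inj₂ refl))

      partner-unique : ∀ {e v} → e ∈ matching → Incident (G k) e v → partner v ≡ e
      partner-unique e∈M e∼v with ∈-select⁻ matched? e∈M
      ... | inj₁ (i , h , refl) with incident⁻ (G k) (ends-ab i) e∼v
      ...   | inj₁ refl = trans (vertexCase-a i) (partnerOf-∈ ac α h)
      ...   | inj₂ refl = trans (vertexCase-b i) (partnerOf-∈ bd β h)
      partner-unique e∈M e∼v | inj₂ (inj₁ (i , h , refl)) with incident⁻ (G k) (ends-ac i (to α i)) e∼v
      ...   | inj₁ refl = trans (vertexCase-a i) (partnerOf-∉ ac α h)
      ...   | inj₂ refl = trans (vertexCase-c _) (cong (λ i′ → ac i′ (to α i)) (from-to α h))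
      partner-unique e∈M e∼v | inj₂ (inj₂ (i , h , refl)) with incident⁻ (G k) (ends-bd i (to β i)) e∼v
      ...   | inj₁ refl = trans (vertexCase-b i) (partnerOf-∉ bd β h)
      ...   | inj₂ refl = trans (vertexCase-d _) (cong (λ i′ → bd i′ (to β i)) (from-to β h))

    matching-perfect : IsPerfectMatching (G k) matching
    matching-perfect v = partner v , proj₁ (partner-covers v) , proj₂ (partner-covers v) ,
                         λ e e∈M e∼v → sym (partner-unique e∈M e∼v)

  private
    2k≡k+k : 2 * k ≡ k + k
    2k≡k+k = cong (_+_ k) (ℕP.+-identityʳ k)

    2k∸k≡k : 2 * k ∸ k ≡ k
    2k∸k≡k = trans (cong (_∸ k) 2k≡k+k) (ℕP.m+n∸m≡n k k)

    ∣∁S∣≡k : ∀ {S : Subset (2 * k)} → ∣ S ∣ ≡ k → ∣ ∁ S ∣ ≡ k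
    ∣∁S∣≡k {S} ∣S∣≡k = trans (∣∁p∣≡n∸∣p∣ S) (trans (cong (2 * k ∸_) ∣S∣≡k) 2k∸k≡k)

    ∣⊥∣≤k : ∣ ⊥ {n = 2 * k} ∣ ≤ k
    ∣⊥∣≤k = subst (_≤ k) (sym (∣⊥∣≡0 (2 * k))) z≤n

    fin₀ : Fin k
    fin₀ = fromℕ< (ℕ.>-nonZero⁻¹ k)

  pair? : Decidable (λ e → ∃ λ i → e ≡ ab i)
  pair? e = any? (λ i → e Fin.≟ ab i)

  pairEdges : Subset (nE (G k))
  pairEdges = select pair?

  ∣pairEdges∣≡2k : ∣ pairEdges ∣ ≡ 2 * k
  ∣pairEdges∣≡2k = ≤-antisym (covered⇒∣p∣≤ ab (map₂ sym ∘ ∈-select⁻ pair?))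
                             (injective⇒≤∣p∣ ab ab-injective (λ i → ∈-select⁺ pair? (i , refl)))

  -- a_i is matched along a_i b_i or to some c_j, and distinct such a_i get distinct c_j.
  k≤∣M∩pairEdges∣ : ∀ {M} → IsPerfectMatching (G k) M → k ≤ ∣ M ∩ pairEdges ∣
  k≤∣M∩pairEdges∣ {M} perfect = ℕP.+-cancelʳ-≤ k k _
    (subst (_≤ ∣ M ∩ pairEdges ∣ + k) 2k≡k+k
      (FinP.injective⇒≤ {f = λ i → code i (a-matched i)}
                        λ {i} {i′} → code-injective (a-matched i) (a-matched i′)))
    where
    a-matched : ∀ i → ab i ∈ M ⊎ ∃ λ j → ac i j ∈ M
    a-matched i with e , e∈M , e∼a , _ ← perfect (a i) with incident-a e∼a
    ... | inj₁ refl       = inj₁ e∈M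
    ... | inj₂ (j , refl) = inj₂ (j , e∈M)

    c-matched-once : ac i j ∈ M → ac i′ j ∈ M → i ≡ i′
    c-matched-once {i} {j} {i′} h h′ with _ , _ , _ , unique ← perfect (c j) =
      proj₁ (ac-injective (trans (unique _ h (incident⁺ (G k) (ends-ac i j) (inj₂ refl)))
                                 (sym (unique _ h′ (incident⁺ (G k) (ends-ac i′ j) (inj₂ refl))))))

    code : ∀ i → ab i ∈ M ⊎ ∃ (λ j → ac i j ∈ M) → Fin (∣ M ∩ pairEdges ∣ + k)
    code i (inj₁ h)       = rank (x∈p∩q⁺ (h , ∈-select⁺ pair? (i , refl))) ↑ˡ k
    code i (inj₂ (j , _)) = ∣ M ∩ pairEdges ∣ ↑ʳ j

    code-injective : ∀ {i i′} x x′ → code i x ≡ code i′ x′ → i ≡ i′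
    code-injective (inj₁ _) (inj₁ _)  eq =
      ab-injective (rank-injective {p = M ∩ pairEdges} _ _ (↑ˡ-injective k _ _ eq))
    code-injective (inj₁ _) (inj₂ _)  eq = contradiction eq (↑ˡ≢↑ʳ _ _)
    code-injective (inj₂ _) (inj₁ _)  eq = contradiction (sym eq) (↑ˡ≢↑ʳ _ _)
    code-injective (inj₂ (j , h)) (inj₂ (j′ , h′)) eq with ↑ʳ-injective _ j j′ eq
    ... | refl = c-matched-once h h′

  module _ (F : Subset (nE (G k))) (∣F∣≤k : ∣ F ∣ ≤ k) where

    private
      blockedPairs : Subset (2 * k)
      blockedPairs = select (λ i → ab i ∈? F)

      k≤∣∁blockedPairs∣ : k ≤ ∣ ∁ blockedPairs ∣
      k≤∣∁blockedPairs∣ = begin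
        k                        ≡⟨ 2k∸k≡k ⟨
        2 * k ∸ k                ≤⟨ ℕP.∸-monoʳ-≤ (2 * k) (≤-trans ∣blockedPairs∣≤∣F∣ ∣F∣≤k) ⟩
        2 * k ∸ ∣ blockedPairs ∣ ≡⟨ ∣∁p∣≡n∸∣p∣ blockedPairs ⟨
        ∣ ∁ blockedPairs ∣       ∎
        where
        open ℕP.≤-Reasoning
        ∣blockedPairs∣≤∣F∣ : ∣ blockedPairs ∣ ≤ ∣ F ∣
        ∣blockedPairs∣≤∣F∣ =
          injective⇒≤∣p∣ (ab ∘ enum blockedPairs) (enum-injective blockedPairs ∘ ab-injective)
                         (∈-select⁻ (λ i → ab i ∈? F) ∘ enum-∈ blockedPairs)

      CrossEscapes : Subset (2 * k) → Set
      CrossEscapes S = Empty F ⊎ ∃ λ e → e ∈ F × ∀ i j → i ∈ ∁ S → ac i j ≢ e × bd i j ≢ e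

      matching-avoiding-over : ∀ S → S ⊆ ∁ blockedPairs → ∣ S ∣ ≡ k → CrossEscapes S →
                               ∃ λ M → IsPerfectMatchingAvoiding (G k) F M
      matching-avoiding-over S S⊆free ∣S∣≡k escapes =
        matching S (rotated ε r) (rotated ε r′) , matching-perfect S (rotated ε r) (rotated ε r′) , avoids
        where
        ε : ∁ S ↔Fin k
        ε = ↔Fin-of-size (∣∁S∣≡k {S} ∣S∣≡k) fin₀

        avoiding-shift :
          ∀ (cross : Index → Fin k → Edge) →
          (∀ {i i′ j j′} → cross i j ≡ cross i′ j′ → i ≡ i′ × j ≡ j′) →
          (∀ {e} → (∀ i j → i ∈ ∁ S → ac i j ≢ e × bd i j ≢ e) → ∀ i j → i ∈ ∁ S → cross i j ≢ e) →
          ∃ λ r → ∀ t → cross (from ε t) (rotate r t) ∉ F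
        avoiding-shift cross cross-injective escaping =
          rotation-avoiding F (λ t → cross (from ε t)) ed-injective ∣F∣≤k
          (case escapes of λ where
            (inj₁ empty)          → inj₁ empty
            (inj₂ (e , e∈F , h)) → inj₂ (e , e∈F , λ t j → escaping h (from ε t) j (from-∈ ε t)))
          where
          ed-injective : ∀ {s t i j} → cross (from ε s) i ≡ cross (from ε t) j → s ≡ t × i ≡ j
          ed-injective = map₁ (from-injective ε) ∘ cross-injective

        shiftAC : ∃ λ r → ∀ t → ac (from ε t) (rotate r t) ∉ F
        shiftAC = avoiding-shift ac ac-injective (λ h i j → proj₁ ∘ h i j)

        shiftBD : ∃ λ r → ∀ t → bd (from ε t) (rotate r t) ∉ F
        shiftBD = avoiding-shift bd bd-injective (λ h i j → proj₂ ∘ h i j)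

        r r′ : Fin k
        r  = proj₁ shiftAC
        r′ = proj₁ shiftBD

        avoids : ∀ e → e ∈ matching S (rotated ε r) (rotated ε r′) → e ∉ F
        avoids e e∈M with ∈-select⁻ (matched? S (rotated ε r) (rotated ε r′)) e∈M
        ... | inj₁ (i , i∈S , refl) =
          λ ab∈F → x∈∁p⇒x∉p (S⊆free i∈S) (∈-select⁺ (λ i → ab i ∈? F) ab∈F)
        ... | inj₂ (inj₁ (i , i∈∁S , refl)) =
          subst (λ i′ → ac i′ (rotate r (to ε i)) ∉ F) (from-to ε i∈∁S) (proj₂ shiftAC (to ε i))
        ... | inj₂ (inj₂ (i , i∈∁S , refl)) =
          subst (λ i′ → bd i′ (rotate r′ (to ε i)) ∉ F) (from-to ε i∈∁S) (proj₂ shiftBD (to ε i))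

      matching-avoiding-above : ∀ {u} → u ⊆ ∁ blockedPairs → ∣ u ∣ ≤ k →
                                (∀ {S} → u ⊆ S → CrossEscapes S) →
                                ∃ λ M → IsPerfectMatchingAvoiding (G k) F M
      matching-avoiding-above u⊆free ∣u∣≤k escapes
        with S , u⊆S , S⊆free , ∣S∣≡k ← ⊆-interpolate u⊆free ∣u∣≤k k≤∣∁blockedPairs∣
        = matching-avoiding-over S S⊆free ∣S∣≡k (escapes u⊆S)

    perfect-matching-avoiding : ∃ λ M → IsPerfectMatchingAvoiding (G k) F M
    perfect-matching-avoiding with any? (λ i → ab i ∈? F) | nonempty? F
    ... | yes (i , ab∈F) | _ = matching-avoiding-above ⊥⊆ ∣⊥∣≤k λ _ →
      inj₂ (ab i , ab∈F , λ _ _ _ → ≢-sym ab≢ac , ≢-sym ab≢bd)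
    ... | no _ | no empty = matching-avoiding-above ⊥⊆ ∣⊥∣≤k λ _ → inj₁ empty
    ... | no no-ab | yes (e , e∈F) = through (edgeView e) e∈F
      where
      singleton-free : ∀ i → ⁅ i ⁆ ⊆ ∁ blockedPairs
      singleton-free i h rewrite x∈⁅y⁆⇒x≡y i h =
        x∉p⇒x∈∁p λ i∈blockedPairs → no-ab (i , ∈-select⁻ (λ i → ab i ∈? F) i∈blockedPairs)

      singleton≤k : ∀ i → ∣ ⁅ i ⁆ ∣ ≤ k
      singleton≤k i = subst (_≤ k) (sym (∣⁅x⁆∣≡1 i)) (ℕ.>-nonZero⁻¹ k)

      -- an edge a_i c_j of F escapes every S containing i; dually for b_i d_j
      through : ∀ {e} → EdgeView e → e ∈ F → ∃ λ M → IsPerfectMatchingAvoiding (G k) F M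
      through (AB i)   ab∈F = contradiction (i , ab∈F) no-ab
      through (AC i j) ac∈F = matching-avoiding-above (singleton-free i) (singleton≤k i) λ u⊆S →
        inj₂ (ac i j , ac∈F , λ i′ j′ i′∈∁S →
          (λ eq → x∈∁p⇒x∉p i′∈∁S (subst (_∈ _) (sym (proj₁ (ac-injective eq))) (u⊆S (x∈⁅x⁆ i)))) ,
          ≢-sym ac≢bd)
      through (BD i j) bd∈F = matching-avoiding-above (singleton-free i) (singleton≤k i) λ u⊆S →
        inj₂ (bd i j , bd∈F , λ i′ j′ i′∈∁S →
          ac≢bd ,
          (λ eq → x∈∁p⇒x∉p i′∈∁S (subst (_∈ _) (sym (proj₁ (bd-injective eq))) (u⊆S (x∈⁅x⁆ i)))))

  precludes⇒k+1≤∣F∣ : ∀ F → Precludes (G k) F → k + 1 ≤ ∣ F ∣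
  precludes⇒k+1≤∣F∣ F precludes = subst (_≤ ∣ F ∣) (+-comm 1 k) (decidable-stable (k ℕP.<? ∣ F ∣)
    λ k≮∣F∣ → precludes (perfect-matching-avoiding F (ℕP.≮⇒≥ k≮∣F∣)))

  ∣star-a∣≤k+1 : ∀ i → ∣ star (G k) (a i) ∣ ≤ k + 1
  ∣star-a∣≤k+1 i = subst (∣ star (G k) (a i) ∣ ≤_) (+-comm 1 k) (covered⇒∣p∣≤ edgeAt cover)
    where
    edgeAt : Fin (suc k) → Edge
    edgeAt zero    = ab i
    edgeAt (suc j) = ac i j

    cover : ∀ {e} → e ∈ star (G k) (a i) → ∃ λ t → edgeAt t ≡ e
    cover h with incident-a (∈-select⁻ (λ e → incident? (G k) e (a i)) h)
    ... | inj₁ refl       = zero , refl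
    ... | inj₂ (j , refl) = suc j , refl

  ∣star-a∣≡k+1 : ∀ i → ∣ star (G k) (a i) ∣ ≡ k + 1
  ∣star-a∣≡k+1 i = ≤-antisym (∣star-a∣≤k+1 i) (precludes⇒k+1≤∣F∣ _ (star-precludes (G k) (a i)))

  pairWeights : Fin (nE (G k)) → ℚ
  pairWeights = constOn pairEdges (1/ℕ k)

  pairWeights-feasible : FeasibleFMP (G k) pairWeights
  pairWeights-feasible = constOn-nonNegative pairEdges (0≤1/ℕ k) , λ M perfect → begin
    1ℚ                           ≡⟨ k·1/ℕ≡1 k ⟨
    k · 1/ℕ k                    ≤⟨ ·-monoˡ-≤ (0≤1/ℕ k) (k≤∣M∩pairEdges∣ perfect) ⟩
    ∣ M ∩ pairEdges ∣ · 1/ℕ k    ≡⟨ incidenceDot-constOn M pairEdges (1/ℕ k) ⟨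
    incidenceDot M pairWeights   ∎
    where open ℚP.≤-Reasoning

  sum-pairWeights : sumℚ pairWeights ≡ + 2 / 1
  sum-pairWeights = begin
    sumℚ pairWeights                 ≡⟨ incidenceDot-⊤ pairWeights ⟨
    incidenceDot ⊤ pairWeights       ≡⟨ incidenceDot-constOn ⊤ pairEdges (1/ℕ k) ⟩
    ∣ ⊤ ∩ pairEdges ∣ · 1/ℕ k        ≡⟨ cong (λ P → ∣ P ∣ · 1/ℕ k) (∩-identityˡ pairEdges) ⟩
    ∣ pairEdges ∣ · 1/ℕ k            ≡⟨ cong (_· 1/ℕ k) (trans ∣pairEdges∣≡2k 2k≡k+k) ⟩
    (k + k) · 1/ℕ k                  ≡⟨ ×-homo-+ (1/ℕ k) k k ⟩
    k · 1/ℕ k ℚ.+ k · 1/ℕ k          ≡⟨ cong₂ ℚ._+_ (k·1/ℕ≡1 k) (k·1/ℕ≡1 k) ⟩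
    1ℚ ℚ.+ 1ℚ                        ≡⟨⟩
    + 2 / 1                          ∎
    where open ≡-Reasoning

  two-disjoint-perfect-matchings :
    ∃₂ λ M M′ → IsPerfectMatching (G k) M × IsPerfectMatching (G k) M′ × (∀ {e} → e ∈ M → e ∉ M′)
  two-disjoint-perfect-matchings
    with S , _ , _ , ∣S∣≡k ← ⊆-interpolate {u = ⊥} {⊤} ⊆⊤ ∣⊥∣≤k
                                (subst (k ≤_) (sym (∣⊤∣≡n (2 * k))) (ℕP.m≤m+n k _))
    = matching S ε ε , matching (∁ S) ε′ ε′
    , matching-perfect S ε ε , matching-perfect (∁ S) ε′ ε′ , disjoint
    where
    ε : ∁ S ↔Fin k
    ε = ↔Fin-of-size (∣∁S∣≡k {S} ∣S∣≡k) fin₀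

    ε′ : ∁ (∁ S) ↔Fin k
    ε′ = ↔Fin-of-size (∣∁S∣≡k {∁ S} (∣∁S∣≡k {S} ∣S∣≡k)) fin₀

    -- the first matching uses a_i b_i iff i ∈ S and the other edges at index i iff i ∉ S;
    -- the second one the other way round
    disjoint : ∀ {e} → e ∈ matching S ε ε → e ∉ matching (∁ S) ε′ ε′
    disjoint e∈M e∈M′ with ∈-select⁻ (matched? S ε ε) e∈M | ∈-select⁻ (matched? (∁ S) ε′ ε′) e∈M′
    ... | inj₁ (i , i∈S , refl) | inj₁ (_ , i′∈∁S , eq) =
      x∈∁p⇒x∉p (subst (_∈ ∁ S) (sym (ab-injective eq)) i′∈∁S) i∈S
    ... | inj₁ (_ , _ , refl) | inj₂ (inj₁ (_ , _ , eq)) = ab≢ac eq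
    ... | inj₁ (_ , _ , refl) | inj₂ (inj₂ (_ , _ , eq)) = ab≢bd eq
    ... | inj₂ (inj₁ (_ , _ , refl)) | inj₁ (_ , _ , eq) = ab≢ac (sym eq)
    ... | inj₂ (inj₁ (i , i∈∁S , refl)) | inj₂ (inj₁ (_ , i′∈∁∁S , eq)) =
      x∈∁p⇒x∉p i′∈∁∁S (subst (_∈ ∁ S) (proj₁ (ac-injective eq)) i∈∁S)
    ... | inj₂ (inj₁ (_ , _ , refl)) | inj₂ (inj₂ (_ , _ , eq)) = ac≢bd eq
    ... | inj₂ (inj₂ (_ , _ , refl)) | inj₁ (_ , _ , eq) = ab≢bd (sym eq)
    ... | inj₂ (inj₂ (_ , _ , refl)) | inj₂ (inj₁ (_ , _ , eq)) = ac≢bd (sym eq)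
    ... | inj₂ (inj₂ (i , i∈∁S , refl)) | inj₂ (inj₂ (_ , i′∈∁∁S , eq)) =
      x∈∁p⇒x∉p i′∈∁∁S (subst (_∈ ∁ S) (proj₁ (bd-injective eq)) i∈∁S)

theorem3p13 : (k : ℕ) → 1 ≤ k →
    MatchingPreclusionNumber (G k) (k + 1) ×
    FractionalMatchingPreclusionNumber (G k) (+ 2 / 1)
theorem3p13 k@(suc _) _ =
  ( (star (G k) (a k zero) , ∣star-a∣≡k+1 k zero , star-precludes (G k) (a k zero))
  , precludes⇒k+1≤∣F∣ k )
  , ( (pairWeights k , pairWeights-feasible k , sum-pairWeights k)
    , λ y feasible → let _ , _ , perfect , perfect′ , disjoint = two-disjoint-perfect-matchings k in
                     disjoint-perfect-matchings⇒2≤ (G k) perfect perfect′ disjoint y feasible )
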